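{- Let $X$ be a finite set and let $\pi\in\Pi_l(X)$ be a labelled set partition with at least one labelled and at least one unlabelled block. Then $\mu_{\Pi_l(X)}(\pi,\hat{1}_l)=0$, where $\hat 1_l=\{X\cup\{l\}\}$ is the maximum of $\Pi_l(X)$.
   Context: For a finite set $X$ and a symbol $l\notin X$, a labelled set partition of $X$ is a collection $\pi=\{B_1\cup L_1,\dots,B_k\cup L_k\}$ where $\{B_1,\dots,B_k\}$ is a set partition of $X$ (non-empty, pairwise disjoint blocks with union $X$) and each $L_i\in\{\emptyset,\{l\}\}$; the block is labelled if $L_i=\{l\}$ and unlabelled otherwise. $\Pi_l(X)$ is the set of all such, partially ordered by $\sigma\le\pi$ iff every block of $\sigma$ (as a set, including $l$ if present) is contained in some block of $\pi$. $\mu_{\Pi_l(X)}$ is the Möbius function of this poset: $\mu(x,x)=1$, $\sum_{x\le z\le y}\mu(x,z)=0$ for $x<y$, and $\mu(x,y)=0$ if $x\not\le y$. -}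

module Defs where

open import Data.Bool using (Bool; true; false; if_then_else_; _∧_)
open import Data.Bool.Properties using () renaming (_≟_ to _≟ᵇ_)
open import Data.Nat using (ℕ; zero; suc)
open import Data.Fin using (Fin; zero; suc)
open import Data.Fin.Properties using (all?)
open import Data.Vec using (Vec; []; _∷_; lookup; replicate)
open import Data.Vec.Properties using (≡-dec)
open import Data.List using (List; []; _∷_; map; concatMap; foldr)
open import Data.Integer using (ℤ; _+_; 0ℤ; 1ℤ)
open import Data.Product using (Σ; _×_; ∃)
open import Relation.Nullary using (¬_; Dec; does)
open import Relation.Nullary.Decidable using (_×-dec_; _→-dec_)
open import Relation.Binary.PropositionalEquality using (_≡_; _≢_)

-- The ground set X ∪ {l} is encoded as Fin (suc n): index `zero` is the
-- label l, index `suc x` is the element x ∈ X.  A block (B ∪ L) is a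
-- subset of X ∪ {l}, i.e. a Vec Bool (suc n).
--
-- A labelled set partition π is encoded by the function x ↦ (the block of
-- π containing x), i.e. a vector of n blocks.  The collection of blocks of
-- π is the image of this map.

Block : ℕ → Set
Block n = Vec Bool (suc n)

Raw : ℕ → Set
Raw n = Vec (Block n) n

blk : ∀ {n} → Raw n → Fin n → Block n
blk π x = lookup π x

-- This says exactly that the image of blk is a labelled
-- set partition of X (blocks nonempty on X, pairwise disjoint, covering X,
-- each containing l or not) and that blk x is the block containing x.
Valid : ∀ {n} → Raw n → Set
Valid {n} π = ∀ (x y : Fin n) →
  ((lookup (blk π x) (suc y) ≡ true → blk π x ≡ blk π y) ×
   (blk π x ≡ blk π y → lookup (blk π x) (suc y) ≡ true))

valid? : ∀ {n} (π : Raw n) → Dec (Valid π)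
valid? π = all? λ x → all? λ y →
  ((lookup (blk π x) (suc y) ≟ᵇ true) →-dec ≡-dec _≟ᵇ_ (blk π x) (blk π y)) ×-dec
  (≡-dec _≟ᵇ_ (blk π x) (blk π y) →-dec (lookup (blk π x) (suc y) ≟ᵇ true))

-- σ ≤ π iff every block of σ (including l if present) is contained in some
-- block of π; the block of σ containing x can only lie in the block of π
-- containing x, so this unfolds to the following.
_≤ₗ_ : ∀ {n} → Raw n → Raw n → Set
_≤ₗ_ {n} σ π = ∀ (x : Fin n) (i : Fin (suc n)) →
  lookup (blk σ x) i ≡ true → lookup (blk π x) i ≡ true

≤ₗ? : ∀ {n} (σ π : Raw n) → Dec (σ ≤ₗ π)
≤ₗ? σ π = all? λ x → all? λ i →
  (lookup (blk σ x) i ≟ᵇ true) →-dec (lookup (blk π x) i ≟ᵇ true)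

_<ₗ_ : ∀ {n} → Raw n → Raw n → Set
σ <ₗ π = σ ≤ₗ π × σ ≢ π

top : ∀ n → Raw n
top n = replicate n (replicate (suc n) true)

HasLabelled : ∀ {n} → Raw n → Set
HasLabelled π = ∃ λ x → lookup (blk π x) zero ≡ true

HasUnlabelled : ∀ {n} → Raw n → Set
HasUnlabelled π = ∃ λ x → lookup (blk π x) zero ≡ false

vecsOf : ∀ {A : Set} → List A → (k : ℕ) → List (Vec A k)
vecsOf xs zero    = [] ∷ []
vecsOf xs (suc k) = concatMap (λ a → map (a ∷_) (vecsOf xs k)) xs

allRaw : ∀ n → List (Raw n)
allRaw n = vecsOf (vecsOf (true ∷ false ∷ []) (suc n)) n

sumℤ : List ℤ → ℤ
sumℤ = foldr _+_ 0ℤ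

intervalSum : ∀ n → (Raw n → Raw n → ℤ) → Raw n → Raw n → ℤ
intervalSum n m x y = sumℤ (map (λ z →
  if does (valid? z) ∧ does (≤ₗ? x z) ∧ does (≤ₗ? z y) then m x z else 0ℤ)
  (allRaw n))

-- m is the Möbius function of Π_l(X) (on valid elements): the defining
-- equations.  These determine m uniquely on Π_l(X) × Π_l(X).
IsMobius : ∀ n → (Raw n → Raw n → ℤ) → Set
IsMobius n m =
  (∀ x → Valid x → m x x ≡ 1ℤ) ×
  (∀ x y → Valid x → Valid y → x <ₗ y → intervalSum n m x y ≡ 0ℤ) ×
  (∀ x y → Valid x → Valid y → ¬ (x ≤ₗ y) → m x y ≡ 0ℤ)

module Submission where

-- Labelling every block, σ ↦ σ⁺, is a closure operator on
-- Π_l(X) (extensive, idempotent, σ ≤ ρ⁺ = ρ ⇒ σ⁺ ≤ ρ), whose closed elements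
-- are the partitions all of whose blocks are labelled.  For such an
-- operator Rota's closure argument applies: if x is not closed, then for
-- every closed y ≥ x the fibre sum  Σ_{z ≥ x, z⁺ = y} μ(x,z)  vanishes.
-- Indeed, the interval [x,y] is the disjoint union of the fibres over the
-- closed w ∈ [x,y]; the interval sum is 0 because x ≠ y, and the fibres
-- over closed w < y vanish by induction, so the fibre over y vanishes too.
-- For the theorem take x = π (not closed, as it has an unlabelled block)
-- and y = 1̂_l: since π has a labelled block, the only z ≥ π with z⁺ = 1̂_l
-- is 1̂_l itself, so the fibre sum over 1̂_l is just μ(π, 1̂_l).

open import Defs
open import Data.Nat using (ℕ)
open import Data.Integer using (ℤ; 0ℤ)
open import Relation.Binary.PropositionalEquality using (_≡_)

open import Data.Bool using (Bool; true; false; if_then_else_; _∧_)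
open import Data.Bool.Properties using () renaming (_≟_ to _≟ᵇ_)
open import Data.Nat using (suc; _<_; _≤_; z≤n; s≤s)
open import Data.Nat.Properties using (m≤n⇒m≤1+n; +-mono-≤; +-mono-<-≤; +-monoʳ-<)
import Data.Nat as Nat
open import Data.Nat.Induction using (<-wellFounded)
open import Data.Fin using (Fin; zero; suc)
open import Data.Vec using (Vec; []; _∷_; lookup; replicate)
import Data.Vec as Vec
open import Data.Vec.Properties
  using (≡-dec; lookup-map; lookup-replicate; tabulate∘lookup; tabulate-cong; map-∘; map-cong; map-replicate)
open import Data.List using (List; []; _∷_; map; concatMap; _++_)
open import Data.Integer using (_+_)
open import Data.Integer.Properties using (+-identityˡ; +-identityʳ; +-assoc; +-commutativeSemigroup)
open import Algebra.Properties.CommutativeSemigroup +-commutativeSemigroup using (interchange)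
open import Data.Product using (_×_; _,_; proj₁; proj₂)
open import Data.Empty using (⊥-elim)
open import Function using (_∘_)
open import Relation.Nullary using (¬_; Dec; yes; no; does)
open import Relation.Nullary.Decidable using (_×-dec_)
open import Relation.Binary.Definitions using (DecidableEquality)
open import Relation.Binary.PropositionalEquality using (refl; sym; trans; cong; cong₂; subst; _≢_; module ≡-Reasoning)
open import Induction.WellFounded using (module All)
import Relation.Binary.Construct.On as On

open ≡-Reasoning

-- Finite sums over lists.  `sumOver xs F` is the shape in which Defs
-- writes interval sums, so these lemmas apply to them directly.

sumOver : {A : Set} → List A → (A → ℤ) → ℤ
sumOver xs F = sumℤ (map F xs)

Σ-cong : {A : Set} (xs : List A) {F G : A → ℤ} → (∀ a → F a ≡ G a) →
  sumOver xs F ≡ sumOver xs G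
Σ-cong []       F≗G = refl
Σ-cong (x ∷ xs) F≗G = cong₂ _+_ (F≗G x) (Σ-cong xs F≗G)

Σ-zero : {A : Set} (xs : List A) → sumOver xs (λ _ → 0ℤ) ≡ 0ℤ
Σ-zero []       = refl
Σ-zero (x ∷ xs) = trans (+-identityˡ _) (Σ-zero xs)

Σ-+ : {A : Set} (xs : List A) (F G : A → ℤ) →
  sumOver xs (λ a → F a + G a) ≡ sumOver xs F + sumOver xs G
Σ-+ []       F G = refl
Σ-+ (x ∷ xs) F G =
  trans (cong ((F x + G x) +_) (Σ-+ xs F G)) (interchange (F x) (G x) _ _)

Σ-swap : {A B : Set} (xs : List A) (ys : List B) (F : A → B → ℤ) →
  sumOver xs (λ a → sumOver ys (F a)) ≡ sumOver ys (λ b → sumOver xs (λ a → F a b))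
Σ-swap []       ys F = sym (Σ-zero ys)
Σ-swap (x ∷ xs) ys F =
  trans (cong (sumOver ys (F x) +_) (Σ-swap xs ys F))
        (sym (Σ-+ ys (F x) (λ b → sumOver xs (λ a → F a b))))

Σ-++ : {A : Set} (xs ys : List A) (F : A → ℤ) →
  sumOver (xs ++ ys) F ≡ sumOver xs F + sumOver ys F
Σ-++ []       ys F = sym (+-identityˡ _)
Σ-++ (x ∷ xs) ys F = trans (cong (F x +_) (Σ-++ xs ys F)) (sym (+-assoc (F x) _ _))

Σ-concatMap : {A B : Set} (g : A → List B) (xs : List A) (F : B → ℤ) →
  sumOver (concatMap g xs) F ≡ sumOver xs (λ a → sumOver (g a) F)
Σ-concatMap g []       F = refl
Σ-concatMap g (x ∷ xs) F =
  trans (Σ-++ (g x) (concatMap g xs) F) (cong (sumOver (g x) F +_) (Σ-concatMap g xs F))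

Σ-map : {A B : Set} (h : A → B) (xs : List A) (F : B → ℤ) →
  sumOver (map h xs) F ≡ sumOver xs (F ∘ h)
Σ-map h []       F = refl
Σ-map h (x ∷ xs) F = cong (F (h x) +_) (Σ-map h xs F)

when : Bool → ℤ → ℤ
when b m = if b then m else 0ℤ

infixr 5 ⟦_⟧_

⟦_⟧_ : {P : Set} → Dec P → ℤ → ℤ
⟦ d ⟧ m = when (does d) m

when-∧ : ∀ a b m → when (a ∧ b) m ≡ when a (when b m)
when-∧ true  b m = refl
when-∧ false b m = refl

⟦⟧-zero : {P : Set} (d : Dec P) → ⟦ d ⟧ 0ℤ ≡ 0ℤ
⟦⟧-zero (yes _) = refl
⟦⟧-zero (no _)  = refl

⟦⟧-yes : {P : Set} (d : Dec P) {m : ℤ} → P → ⟦ d ⟧ m ≡ m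
⟦⟧-yes (yes _) p = refl
⟦⟧-yes (no ¬p) p = ⊥-elim (¬p p)

⟦⟧-no : {P : Set} (d : Dec P) {m : ℤ} → ¬ P → ⟦ d ⟧ m ≡ 0ℤ
⟦⟧-no (yes p) ¬p = ⊥-elim (¬p p)
⟦⟧-no (no _)  ¬p = refl

⟦⟧-vanish : {P : Set} (d : Dec P) {m : ℤ} → (P → m ≡ 0ℤ) → ⟦ d ⟧ m ≡ 0ℤ
⟦⟧-vanish (yes p) m≡0 = m≡0 p
⟦⟧-vanish (no _)  m≡0 = refl

⟦⟧-under : {P : Set} (d : Dec P) {m m′ : ℤ} → (P → m ≡ m′) → ⟦ d ⟧ m ≡ ⟦ d ⟧ m′
⟦⟧-under (yes p) m≡m′ = m≡m′ p
⟦⟧-under (no _)  m≡m′ = refl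

⟦⟧-cong : {P Q : Set} (d : Dec P) (e : Dec Q) → (P → Q) → (Q → P) → ∀ m → ⟦ d ⟧ m ≡ ⟦ e ⟧ m
⟦⟧-cong (yes _) (yes _) _   _   m = refl
⟦⟧-cong (no _)  (no _)  _   _   m = refl
⟦⟧-cong (yes p) (no ¬q) p→q _   m = ⊥-elim (¬q (p→q p))
⟦⟧-cong (no ¬p) (yes q) _   q→p m = ⊥-elim (¬p (q→p q))

⟦⟧-comm : {P Q : Set} (d : Dec P) (e : Dec Q) (m : ℤ) → ⟦ d ⟧ ⟦ e ⟧ m ≡ ⟦ e ⟧ ⟦ d ⟧ m
⟦⟧-comm (yes _) (yes _) m = refl
⟦⟧-comm (yes _) (no _)  m = refl
⟦⟧-comm (no _)  (yes _) m = refl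
⟦⟧-comm (no _)  (no _)  m = refl

Σ-⟦⟧ : {A P : Set} (xs : List A) (d : Dec P) (G : A → ℤ) →
  sumOver xs (λ a → ⟦ d ⟧ G a) ≡ ⟦ d ⟧ sumOver xs G
Σ-⟦⟧ xs (yes _) G = refl
Σ-⟦⟧ xs (no _)  G = Σ-zero xs

-- Enumerations.  A list enumerates its type (each element exactly once)
-- iff summing the Kronecker delta at any b picks out exactly one term.

Enumerates : {A : Set} → DecidableEquality A → List A → Set
Enumerates {A} _≟_ xs = ∀ (b : A) (c : ℤ) → sumOver xs (λ a → ⟦ a ≟ b ⟧ c) ≡ c

Σ-select : {A : Set} (_≟_ : DecidableEquality A) (xs : List A) → Enumerates _≟_ xs →
  {Pred : A → Set} (Pred? : ∀ a → Dec (Pred a)) (a : A) (m : ℤ) →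
  sumOver xs (λ w → ⟦ Pred? w ⟧ ⟦ a ≟ w ⟧ m) ≡ ⟦ Pred? a ⟧ m
Σ-select _≟_ xs enum Pred? a m =
  trans (Σ-cong xs flip-delta) (enum a (⟦ Pred? a ⟧ m))
  where
    flip-delta : ∀ w → ⟦ Pred? w ⟧ ⟦ a ≟ w ⟧ m ≡ ⟦ w ≟ a ⟧ ⟦ Pred? a ⟧ m
    flip-delta w with a ≟ w | w ≟ a
    ... | yes refl | yes _    = refl
    ... | yes refl | no a≢a   = ⊥-elim (a≢a refl)
    ... | no a≢w   | yes refl = ⊥-elim (a≢w refl)
    ... | no _     | no _     = ⟦⟧-zero (Pred? w)

enumerates-Bool : Enumerates _≟ᵇ_ (true ∷ false ∷ [])
enumerates-Bool true  c = +-identityʳ c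
enumerates-Bool false c = trans (+-identityˡ _) (+-identityʳ c)

enumerates-vecsOf : {A : Set} {_≟_ : DecidableEquality A} {xs : List A} →
  Enumerates _≟_ xs → ∀ k → Enumerates (≡-dec _≟_) (vecsOf xs k)
enumerates-vecsOf enum Nat.zero []      c = +-identityʳ c
enumerates-vecsOf {_≟_ = _≟_} {xs} enum (suc k) (b ∷ v) c = begin
  sumOver (concatMap (λ a → map (a ∷_) (vecsOf xs k)) xs) δ
    ≡⟨ Σ-concatMap (λ a → map (a ∷_) (vecsOf xs k)) xs δ ⟩
  sumOver xs (λ a → sumOver (map (a ∷_) (vecsOf xs k)) δ)
    ≡⟨ Σ-cong xs (λ a → trans (Σ-map (a ∷_) (vecsOf xs k) δ)
                              (Σ-cong (vecsOf xs k) (λ w → when-∧ (does (a ≟ b)) _ c))) ⟩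
  sumOver xs (λ a → sumOver (vecsOf xs k) (λ w → ⟦ a ≟ b ⟧ ⟦ ≡-dec _≟_ w v ⟧ c))
    ≡⟨ Σ-cong xs (λ a → Σ-⟦⟧ (vecsOf xs k) (a ≟ b) (λ w → ⟦ ≡-dec _≟_ w v ⟧ c)) ⟩
  sumOver xs (λ a → ⟦ a ≟ b ⟧ sumOver (vecsOf xs k) (λ w → ⟦ ≡-dec _≟_ w v ⟧ c))
    ≡⟨ Σ-cong xs (λ a → cong (⟦ a ≟ b ⟧_) (enumerates-vecsOf enum k v c)) ⟩
  sumOver xs (λ a → ⟦ a ≟ b ⟧ c)
    ≡⟨ enum b c ⟩
  c ∎
  where
    -- a ∷ w ≡ b ∷ v is decided componentwise, so this delta factors
    -- into the deltas for the head and the tail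
    δ : Vec _ (suc k) → ℤ
    δ u = ⟦ ≡-dec _≟_ u (b ∷ v) ⟧ c

enumerates-allRaw : ∀ n → Enumerates (≡-dec (≡-dec _≟ᵇ_)) (allRaw n)
enumerates-allRaw n =
  enumerates-vecsOf (enumerates-vecsOf enumerates-Bool (suc n)) n

-- Weight.  Boolean vectors/matrices ordered by entrywise implication; the
-- number of `true` entries is strictly monotone, which gives well-founded
-- induction along the (strict) order of Π_l(X).

_⊑_ : ∀ {k} → Vec Bool k → Vec Bool k → Set
b ⊑ c = ∀ i → lookup b i ≡ true → lookup c i ≡ true

trues : ∀ {k} → Vec Bool k → ℕ
trues []          = 0
trues (true ∷ b)  = suc (trues b)
trues (false ∷ b) = trues b

trues-mono : ∀ {k} (b c : Vec Bool k) → b ⊑ c → trues b ≤ trues c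
trues-mono []          []          _   = z≤n
trues-mono (true ∷ b)  (true ∷ c)  b⊑c = s≤s (trues-mono b c (b⊑c ∘ suc))
trues-mono (true ∷ b)  (false ∷ c) b⊑c with b⊑c zero refl
... | ()
trues-mono (false ∷ b) (true ∷ c)  b⊑c = m≤n⇒m≤1+n (trues-mono b c (b⊑c ∘ suc))
trues-mono (false ∷ b) (false ∷ c) b⊑c = trues-mono b c (b⊑c ∘ suc)

trues-strict : ∀ {k} (b c : Vec Bool k) → b ⊑ c → b ≢ c → trues b < trues c
trues-strict []          []          _   b≢c = ⊥-elim (b≢c refl)
trues-strict (true ∷ b)  (true ∷ c)  b⊑c b≢c =
  s≤s (trues-strict b c (b⊑c ∘ suc) (b≢c ∘ cong (true ∷_)))
trues-strict (true ∷ b)  (false ∷ c) b⊑c b≢c with b⊑c zero refl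
... | ()
trues-strict (false ∷ b) (true ∷ c)  b⊑c b≢c = s≤s (trues-mono b c (b⊑c ∘ suc))
trues-strict (false ∷ b) (false ∷ c) b⊑c b≢c =
  trues-strict b c (b⊑c ∘ suc) (b≢c ∘ cong (false ∷_))

-- Entrywise implication of Boolean matrices; `σ ≤ₗ ρ` is literally `σ ⊑* ρ`.
_⊑*_ : ∀ {k m} → Vec (Vec Bool m) k → Vec (Vec Bool m) k → Set
w ⊑* y = ∀ x → lookup w x ⊑ lookup y x

weight : ∀ {k m} → Vec (Vec Bool m) k → ℕ
weight []       = 0
weight (r ∷ rs) = trues r Nat.+ weight rs

weight-mono : ∀ {k m} (w y : Vec (Vec Bool m) k) → w ⊑* y → weight w ≤ weight y
weight-mono []       []       _   = z≤n
weight-mono (r ∷ rs) (s ∷ ss) w⊑y =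
  +-mono-≤ (trues-mono r s (w⊑y zero)) (weight-mono rs ss (w⊑y ∘ suc))

weight-strict : ∀ {k m} (w y : Vec (Vec Bool m) k) → w ⊑* y → w ≢ y → weight w < weight y
weight-strict []       []       _   w≢y = ⊥-elim (w≢y refl)
weight-strict (r ∷ rs) (s ∷ ss) w⊑y w≢y with ≡-dec _≟ᵇ_ r s
... | yes refl = +-monoʳ-< (trues r) (weight-strict rs ss (w⊑y ∘ suc) (w≢y ∘ cong (r ∷_)))
... | no r≢s   = +-mono-<-≤ (trues-strict r s (w⊑y zero) r≢s) (weight-mono rs ss (w⊑y ∘ suc))

module ClosureArgument
  {A : Set} (_≟_ : DecidableEquality A)
  (elems : List A) (elems-enum : Enumerates _≟_ elems)
  (P : A → Set) (P? : ∀ a → Dec (P a))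
  (_≤_ : A → A → Set) (_≤?_ : ∀ a b → Dec (a ≤ b))
  (≤-refl : ∀ a → a ≤ a) (≤-trans : ∀ a b c → a ≤ b → b ≤ c → a ≤ c)
  (rank : A → ℕ) (rank-strict : ∀ a b → a ≤ b → a ≢ b → rank a < rank b)
  (cl : A → A) (cl-P : ∀ a → P a → P (cl a)) (cl-extensive : ∀ a → a ≤ cl a)
  (cl-idempotent : ∀ a → cl (cl a) ≡ cl a)
  (cl-least : ∀ a b → a ≤ b → cl b ≡ b → cl a ≤ b)
  where

  Closed : A → Set
  Closed a = cl a ≡ a

  -- Σ_{z ∈ P, x ≤ z ≤ y} μ(x,z), written exactly as `intervalSum` in Defs.
  intervalTotal : (A → A → ℤ) → A → A → ℤ
  intervalTotal μ x y = sumOver elems (λ z →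
    if does (P? z) ∧ does (x ≤? z) ∧ does (z ≤? y) then μ x z else 0ℤ)

  module _ (μ : A → A → ℤ) (x : A) (x-open : ¬ Closed x)
           (μ-interval : ∀ y → P y → x ≤ y × x ≢ y → intervalTotal μ x y ≡ 0ℤ) where

    Above : A → Set
    Above z = P z × x ≤ z

    above? : ∀ z → Dec (Above z)
    above? z = P? z ×-dec (x ≤? z)

    ClosedIn : A → A → Set
    ClosedIn y w = Above w × Closed w × w ≤ y

    closedIn? : ∀ y w → Dec (ClosedIn y w)
    closedIn? y w = above? w ×-dec (cl w ≟ w) ×-dec (w ≤? y)

    fibre : A → ℤ
    fibre y = sumOver elems (λ z → ⟦ above? z ⟧ ⟦ cl z ≟ y ⟧ μ x z)

    interval-guarded : ∀ y →
      intervalTotal μ x y ≡ sumOver elems (λ z → ⟦ above? z ⟧ ⟦ z ≤? y ⟧ μ x z)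
    interval-guarded y = Σ-cong elems λ z →
      let a = does (P? z); b = does (x ≤? z); c = does (z ≤? y) in
      begin
        when (a ∧ b ∧ c) (μ x z)       ≡⟨ when-∧ a (b ∧ c) _ ⟩
        when a (when (b ∧ c) (μ x z))  ≡⟨ cong (when a) (when-∧ b c _) ⟩
        when a (when b (when c _))     ≡⟨ sym (when-∧ a b _) ⟩
        when (a ∧ b) (when c (μ x z))  ∎

    below-iff-closure-below : ∀ {y z} → Closed y → Above z →
      (z ≤ y → ClosedIn y (cl z)) × (ClosedIn y (cl z) → z ≤ y)
    below-iff-closure-below {y} {z} cy (Pz , x≤z) =
      (λ z≤y → (cl-P z Pz , ≤-trans x z (cl z) x≤z (cl-extensive z))
               , cl-idempotent z , cl-least z y z≤y cy)
      , (λ (_ , _ , clz≤y) → ≤-trans z (cl z) y (cl-extensive z) clz≤y)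

    interval-by-fibres : ∀ y → Closed y →
      sumOver elems (λ z → ⟦ above? z ⟧ ⟦ z ≤? y ⟧ μ x z) ≡
      sumOver elems (λ w → ⟦ closedIn? y w ⟧ fibre w)
    interval-by-fibres y cy = begin
      sumOver elems (λ z → ⟦ above? z ⟧ ⟦ z ≤? y ⟧ μ x z)
        ≡⟨ Σ-cong elems (λ z → ⟦⟧-under (above? z) (split-at-closure z)) ⟩
      sumOver elems (λ z → ⟦ above? z ⟧ sumOver elems (λ w → term z w))
        ≡⟨ Σ-cong elems (λ z → sym (Σ-⟦⟧ elems (above? z) (term z))) ⟩
      sumOver elems (λ z → sumOver elems (λ w → ⟦ above? z ⟧ term z w))
        ≡⟨ Σ-cong elems (λ z → Σ-cong elems (λ w → ⟦⟧-comm (above? z) (closedIn? y w) _)) ⟩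
      sumOver elems (λ z → sumOver elems (λ w → ⟦ closedIn? y w ⟧ ⟦ above? z ⟧ ⟦ cl z ≟ w ⟧ μ x z))
        ≡⟨ Σ-swap elems elems _ ⟩
      sumOver elems (λ w → sumOver elems (λ z → ⟦ closedIn? y w ⟧ ⟦ above? z ⟧ ⟦ cl z ≟ w ⟧ μ x z))
        ≡⟨ Σ-cong elems (λ w → Σ-⟦⟧ elems (closedIn? y w) _) ⟩
      sumOver elems (λ w → ⟦ closedIn? y w ⟧ fibre w) ∎
      where
        term : A → A → ℤ
        term z w = ⟦ closedIn? y w ⟧ ⟦ cl z ≟ w ⟧ μ x z

        split-at-closure : ∀ z → Above z → ⟦ z ≤? y ⟧ μ x z ≡ sumOver elems (term z)
        split-at-closure z az = sym (begin
          sumOver elems (term z)           ≡⟨ Σ-select _≟_ elems elems-enum (closedIn? y) (cl z) (μ x z) ⟩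
          ⟦ closedIn? y (cl z) ⟧ μ x z     ≡⟨ ⟦⟧-cong (closedIn? y (cl z)) (z ≤? y) to from (μ x z) ⟩
          ⟦ z ≤? y ⟧ μ x z                 ∎)
          where
            to = proj₂ (below-iff-closure-below cy az)
            from = proj₁ (below-iff-closure-below cy az)

    fibre-vanishes : ∀ y → Above y → Closed y → fibre y ≡ 0ℤ
    fibre-vanishes = All.wfRec (On.wellFounded rank <-wellFounded) _ Goal step
      where
        Goal : A → Set
        Goal y = Above y → Closed y → fibre y ≡ 0ℤ

        step : ∀ y → (∀ {w} → rank w < rank y → Goal w) → Goal y
        step y ih ay cy = begin
          fibre y                                             ≡⟨ sym (elems-enum y (fibre y)) ⟩
          sumOver elems (λ w → ⟦ w ≟ y ⟧ fibre y)             ≡⟨ Σ-cong elems (λ w → sym (only-y-survives w)) ⟩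
          sumOver elems (λ w → ⟦ closedIn? y w ⟧ fibre w)     ≡⟨ sym (interval-by-fibres y cy) ⟩
          sumOver elems (λ z → ⟦ above? z ⟧ ⟦ z ≤? y ⟧ μ x z) ≡⟨ sym (interval-guarded y) ⟩
          intervalTotal μ x y                                 ≡⟨ μ-interval y (proj₁ ay) (proj₂ ay , x≢y) ⟩
          0ℤ                                                  ∎
          where
            x≢y : x ≢ y
            x≢y refl = x-open cy

            only-y-survives : ∀ w → ⟦ closedIn? y w ⟧ fibre w ≡ ⟦ w ≟ y ⟧ fibre y
            only-y-survives w with w ≟ y
            ... | yes refl = ⟦⟧-yes (closedIn? y y) (ay , cy , ≤-refl y)
            ... | no w≢y   = ⟦⟧-vanish (closedIn? y w)
                               (λ (aw , cw , w≤y) → ih (rank-strict w y w≤y w≢y) aw cw)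

    μ-vanishes : ∀ y → Above y → Closed y → (∀ z → Above z → cl z ≡ y → z ≡ y) → μ x y ≡ 0ℤ
    μ-vanishes y ay cy fibre-is-y = begin
      μ x y                                   ≡⟨ sym (elems-enum y (μ x y)) ⟩
      sumOver elems (λ z → ⟦ z ≟ y ⟧ μ x y)   ≡⟨ Σ-cong elems fibre-term ⟩
      fibre y                                 ≡⟨ fibre-vanishes y ay cy ⟩
      0ℤ                                      ∎
      where
        fibre-term : ∀ z → ⟦ z ≟ y ⟧ μ x y ≡ ⟦ above? z ⟧ ⟦ cl z ≟ y ⟧ μ x z
        fibre-term z with z ≟ y
        ... | yes refl = sym (trans (⟦⟧-yes (above? y) ay) (⟦⟧-yes (cl y ≟ y) cy))
        ... | no z≢y   = sym (⟦⟧-vanish (above? z)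
                                (λ az → ⟦⟧-no (cl z ≟ y) (z≢y ∘ fibre-is-y z az)))

module _ {n : ℕ} where

  label : Block n → Block n
  label (_ ∷ b) = true ∷ b

  label-head : ∀ b → lookup (label b) zero ≡ true
  label-head (_ ∷ _) = refl

  label-tail : ∀ b j → lookup (label b) (suc j) ≡ lookup b (suc j)
  label-tail (_ ∷ _) j = refl

  label-extensive : ∀ b → b ⊑ label b
  label-extensive (_ ∷ _) zero    _ = refl
  label-extensive (_ ∷ _) (suc j) b∋j = b∋j

  label-least : ∀ b c → b ⊑ c → lookup c zero ≡ true → label b ⊑ c
  label-least (_ ∷ _) c b⊑c c∋l zero    _   = c∋l
  label-least (_ ∷ _) c b⊑c c∋l (suc j) b∋j = b⊑c (suc j) b∋j

  label-idempotent : ∀ b → label (label b) ≡ label b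
  label-idempotent (_ ∷ _) = refl

  label-full : ∀ b → label b ≡ replicate (suc n) true → lookup b zero ≡ true →
    b ≡ replicate (suc n) true
  label-full (true ∷ _) b⁺-full _ = b⁺-full

  labelAll : Raw n → Raw n
  labelAll = Vec.map label

  blk-labelAll : ∀ σ x → blk (labelAll σ) x ≡ label (blk σ x)
  blk-labelAll σ x = lookup-map x label σ

  labelAll-valid : ∀ σ → Valid σ → Valid (labelAll σ)
  labelAll-valid σ valid-σ x y rewrite blk-labelAll σ x | blk-labelAll σ y =
      (λ y∈x⁺ → cong label (proj₁ (valid-σ x y) (trans (sym (label-tail (blk σ x) y)) y∈x⁺)))
    , (λ x⁺≡y⁺ → trans (cong (λ b → lookup b (suc y)) x⁺≡y⁺)
                   (trans (label-tail (blk σ y) y) (proj₂ (valid-σ y y) refl)))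

  ≤-labelAll : ∀ σ → σ ≤ₗ labelAll σ
  ≤-labelAll σ x = subst (blk σ x ⊑_) (sym (blk-labelAll σ x)) (label-extensive (blk σ x))

  labelAll-idempotent : ∀ σ → labelAll (labelAll σ) ≡ labelAll σ
  labelAll-idempotent σ = trans (sym (map-∘ label label σ)) (map-cong label-idempotent σ)

  closed⇒labelled : ∀ {ρ} → labelAll ρ ≡ ρ → ∀ x → lookup (blk ρ x) zero ≡ true
  closed⇒labelled {ρ} ρ⁺≡ρ x = subst (λ τ → lookup (blk τ x) zero ≡ true) ρ⁺≡ρ
    (trans (cong (λ b → lookup b zero) (blk-labelAll ρ x)) (label-head (blk ρ x)))

  labelAll-least : ∀ σ ρ → σ ≤ₗ ρ → labelAll ρ ≡ ρ → labelAll σ ≤ₗ ρ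
  labelAll-least σ ρ σ≤ρ ρ⁺≡ρ x = subst (_⊑ blk ρ x) (sym (blk-labelAll σ x))
    (label-least (blk σ x) (blk ρ x) (σ≤ρ x) (closed⇒labelled ρ⁺≡ρ x))

  unlabelled⇒not-closed : ∀ {π} → HasUnlabelled π → labelAll π ≢ π
  unlabelled⇒not-closed (x , l∉πx) π⁺≡π with trans (sym l∉πx) (closed⇒labelled π⁺≡π x)
  ... | ()

  ≤ₗ-refl : (σ : Raw n) → σ ≤ₗ σ
  ≤ₗ-refl σ x i σ∋i = σ∋i

  ≤ₗ-trans : (σ τ ρ : Raw n) → σ ≤ₗ τ → τ ≤ₗ ρ → σ ≤ₗ ρ
  ≤ₗ-trans _ _ _ σ≤τ τ≤ρ x i σ∋i = τ≤ρ x i (σ≤τ x i σ∋i)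

lookup-ext : {A : Set} {k : ℕ} {u v : Vec A k} → (∀ i → lookup u i ≡ lookup v i) → u ≡ v
lookup-ext {u = u} {v} u≗v =
  trans (sym (tabulate∘lookup u)) (trans (tabulate-cong u≗v) (tabulate∘lookup v))

module _ {n : ℕ} where

  blk-top : ∀ x → blk (top n) x ≡ replicate (suc n) true
  blk-top x = lookup-replicate x _

  valid-top : Valid (top n)
  valid-top x y rewrite blk-top x | blk-top y = (λ _ → refl) , (λ _ → lookup-replicate y true)

  ≤-top : ∀ σ → σ ≤ₗ top n
  ≤-top σ x i _ rewrite blk-top x = lookup-replicate i true

  labelAll-top : labelAll (top n) ≡ top n
  labelAll-top = map-replicate label (replicate (suc n) true) n

  -- Every block of σ becomes X ∪ {l} after labelling, so meets the block of
  -- x₀ (labelled in π, hence in σ); by validity it is that block, and it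
  -- contains l, so it already is X ∪ {l}.
  top-fibre : (π σ : Raw n) → HasLabelled π → Valid σ → π ≤ₗ σ → labelAll σ ≡ top n → σ ≡ top n
  top-fibre π σ (x₀ , l∈πx₀) valid-σ π≤σ σ⁺≡top =
    lookup-ext (λ x → trans (block-full x) (sym (blk-top x)))
    where
      labelled-full : ∀ x → label (blk σ x) ≡ replicate (suc n) true
      labelled-full x =
        trans (sym (blk-labelAll σ x)) (trans (cong (λ τ → blk τ x) σ⁺≡top) (blk-top x))

      meets-x₀ : ∀ x → blk σ x ≡ blk σ x₀
      meets-x₀ x = proj₁ (valid-σ x x₀) (begin
        lookup (blk σ x) (suc x₀)                 ≡⟨ sym (label-tail (blk σ x) x₀) ⟩
        lookup (label (blk σ x)) (suc x₀)         ≡⟨ cong (λ b → lookup b (suc x₀)) (labelled-full x) ⟩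
        lookup (replicate (suc n) true) (suc x₀)  ≡⟨ lookup-replicate x₀ true ⟩
        true                                      ∎)

      block-full : ∀ x → blk σ x ≡ replicate (suc n) true
      block-full x = label-full (blk σ x) (labelled-full x)
        (subst (λ b → lookup b zero ≡ true) (sym (meets-x₀ x)) (π≤σ x₀ zero l∈πx₀))

lemma4p7 : (n : ℕ) (μ : Raw n → Raw n → ℤ) → IsMobius n μ →
    (π : Raw n) → Valid π → HasLabelled π → HasUnlabelled π →
    μ π (top n) ≡ 0ℤ
lemma4p7 n μ isM π valid-π labelled unlabelled =
  μ-vanishes μ π (unlabelled⇒not-closed unlabelled) interval-zero
    (top n) (valid-top , ≤-top π) labelAll-top
    (λ σ (valid-σ , π≤σ) → top-fibre π σ labelled valid-σ π≤σ)
  where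
    open ClosureArgument (≡-dec (≡-dec _≟ᵇ_)) (allRaw n) (enumerates-allRaw n)
      Valid (valid? {n}) _≤ₗ_ (≤ₗ? {n}) ≤ₗ-refl ≤ₗ-trans weight weight-strict
      labelAll labelAll-valid ≤-labelAll labelAll-idempotent labelAll-least

    interval-zero : ∀ y → Valid y → π <ₗ y → intervalSum n μ π y ≡ 0ℤ
    interval-zero y valid-y = proj₁ (proj₂ isM) π y valid-π valid-y
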